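{- If an HDA $Q$ has repeating events (i.e. does not have non-repeating events), then it cannot be sculpted, i.e. there is no HDA embedding of $Q$ into any bulk $B^d$.
   Context: Precubical sets: families of disjoint sets $Q_n$ with face maps $s_k,t_k:Q_n\to Q_{n-1}$ ($k=1,\dots,n$) satisfying $\alpha_k\beta_\ell=\beta_{\ell-1}\alpha_k$ for $\alpha,\beta\in\{s,t\}$, $k<\ell$. An HDA is a finite precubical set with initial cell $I\in Q_0$; HDA morphisms commute with face maps and preserve the initial cell; embeddings are injective HDA morphisms. The bulk $B^d$ has $n$-cells the tuples in $\{0,\ast,1\}^d$ with exactly $n$ entries $\ast$; $s_k$ (resp. $t_k$) replaces the $k$-th $\ast$ by $0$ (resp. $1$); initial cell $(0,\dots,0)$. Universal labels: $\approx$ is the equivalence on $Q_1$ generated by $(s_iq,t_iq)$ for $q\in Q_2$, $i\in\{1,2\}$; $\lambda(e)$ is the class of $e\in Q_1$. A sequential path is a sequence $v_0\xrightarrow{s}e_1\xrightarrow{t}v_1\xrightarrow{s}e_2\xrightarrow{t}v_2\cdots\xrightarrow{s}e_n\xrightarrow{t}v_n$ with $v_j\in Q_0$, $e_j\in Q_1$, where $v\xrightarrow{s}e$ means $s_1(e)=v$ and $e\xrightarrow{t}v$ means $t_1(e)=v$. $Q$ has non-repeating events if for every sequential path the labels $\lambda(e_1),\dots,\lambda(e_n)$ are pairwise distinct. -}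

module Defs where

open import Data.Nat using (ℕ; zero; suc; _≤_)
open import Data.Fin using (Fin; zero; suc; inject₁; toℕ) renaming (_≤_ to _≤ᶠ_)
open import Data.Fin.Properties using (toℕ-inject₁)
open import Data.Bool using (Bool; true; false)
open import Data.Product using (Σ; ∃; ∃-syntax; _×_; _,_)
open import Data.Empty using (⊥)
open import Relation.Nullary using (¬_)
open import Relation.Binary.PropositionalEquality using (_≡_; refl; cong)
open import Function.Bundles using (_↔_)
open import Function.Definitions using (Injective)

-- Cells of dimension n form the type  Cell n  (so the Q_n are disjoint
-- by construction).  A face map is indexed by a Bool α (false = s, true = t)
-- and a 0-indexed position k : Fin (suc n)  (paper index k+1), mapping
-- (n+1)-cells to n-cells.
--
-- Precubical identity  α_k β_ℓ = β_{ℓ-1} α_k  for k < ℓ (1-indexed), on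
-- (n+2)-cells.  In 0-indexed form with ℓ' := ℓ-1 (paper, 1-indexed)
-- ranging over Fin (suc n) and k ≤ ℓ' this reads
--   face α n k (face β (suc n) (suc ℓ') x)
--     ≡ face β n ℓ' (face α (suc n) (inject₁ k) x).

record PrecubicalSet : Set₁ where
  field
    Cell : ℕ → Set
    face : Bool → (n : ℕ) → Fin (suc n) → Cell (suc n) → Cell n
    cubical : ∀ (α β : Bool) (n : ℕ) (k ℓ : Fin (suc n)) → k ≤ᶠ ℓ →
              (x : Cell (suc (suc n))) →
              face α n k (face β (suc n) (suc ℓ) x)
                ≡ face β n ℓ (face α (suc n) (inject₁ k) x)

open PrecubicalSet public

record Pointed : Set₁ where
  field
    pcs  : PrecubicalSet
    init : Cell pcs 0

open Pointed public

Finite : PrecubicalSet → Set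
Finite Q = Σ (ℕ → ℕ) λ size →
             ((n : ℕ) → Cell Q n ↔ Fin (size n)) ×
             ∃[ N ] ((n : ℕ) → N ≤ n → size n ≡ 0)

record HDA : Set₁ where
  field
    pointed : Pointed
    finite  : Finite (pcs pointed)

open HDA public

record Morphism (Q R : Pointed) : Set where
  private
    CQ = pcs Q
    CR = pcs R
  field
    map      : (n : ℕ) → Cell CQ n → Cell CR n
    map-face : (α : Bool) (n : ℕ) (k : Fin (suc n)) (x : Cell CQ (suc n)) →
               map n (face CQ α n k x) ≡ face CR α n k (map (suc n) x)
    map-init : map 0 (init Q) ≡ init R

open Morphism public

record Embedding (Q R : Pointed) : Set where
  field
    morphism  : Morphism Q R
    injective : (n : ℕ) → Injective _≡_ _≡_ (map morphism n)

-- The bulk B^d.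
-- BCell d n : tuples in {0,*,1}^d with exactly n entries *, built
-- letter by letter (b0 = 0, b1 = 1, b* = *).

data BCell : ℕ → ℕ → Set where
  []  : BCell 0 0
  b0  : ∀ {d n} → BCell d n → BCell (suc d) n
  b1  : ∀ {d n} → BCell d n → BCell (suc d) n
  b*  : ∀ {d n} → BCell d n → BCell (suc d) (suc n)

fill : ∀ {d n} → Bool → BCell d n → BCell (suc d) n
fill false x = b0 x
fill true  x = b1 x

-- replace the k-th * (0-indexed) by 0 (α = false) or 1 (α = true)
bface : ∀ {d n} → Bool → Fin (suc n) → BCell d (suc n) → BCell d n
bface α k     (b0 x) = b0 (bface α k x)
bface α k     (b1 x) = b1 (bface α k x)
bface α zero (b* x) = fill α x
bface {suc d} {suc n} α (suc k) (b* x) = b* (bface α k x)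

bcubical : ∀ {d} (α β : Bool) (n : ℕ) (k ℓ : Fin (suc n)) → k ≤ᶠ ℓ →
           (x : BCell d (suc (suc n))) →
           bface α k (bface β (suc ℓ) x) ≡ bface β ℓ (bface α (inject₁ k) x)
bcubical α β n k ℓ le (b0 x) = cong b0 (bcubical α β n k ℓ le x)
bcubical α β n k ℓ le (b1 x) = cong b1 (bcubical α β n k ℓ le x)
bcubical false false n zero ℓ le (b* x) = refl
bcubical false true n zero ℓ le (b* x) = refl
bcubical true false n zero ℓ le (b* x) = refl
bcubical true true n zero ℓ le (b* x) = refl
bcubical α β (suc n) (suc k) (suc ℓ) (Data.Nat.s≤s le) (b* x) =
  cong b* (bcubical α β n k ℓ le x)

Bulk : ℕ → Pointed
Bulk d = record
  { pcs = record
      { Cell = BCell d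
      ; face = λ α n k x → bface α k x
      ; cubical = λ α β n k ℓ le x → bcubical α β n k ℓ le x }
  ; init = zeros d }
  where
    zeros : (m : ℕ) → BCell m 0
    zeros zero = []
    zeros (suc m) = b0 (zeros m)

-- Universal labels: ≈ is the equivalence relation on Q_1 generated by
-- (s_i q, t_i q) for q ∈ Q_2, i ∈ {1,2}.

module _ (Q : PrecubicalSet) where

  data _≈_ : Cell Q 1 → Cell Q 1 → Set where
    gen   : (q : Cell Q 2) (i : Fin 2) → face Q false 1 i q ≈ face Q true 1 i q
    ≈refl : ∀ {e} → e ≈ e
    ≈sym  : ∀ {e f} → e ≈ f → f ≈ e
    ≈trans : ∀ {e f g} → e ≈ f → f ≈ g → e ≈ g

  src tgt : Cell Q 1 → Cell Q 0
  src e = face Q false 0 zero e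
  tgt e = face Q true 0 zero e

  -- A sequential path with m edges e_0,…,e_{m-1}: t_1(e_j) = s_1(e_{j+1})
  -- (the vertices v_j are then determined: v_0 = s_1(e_0), v_{j+1} = t_1(e_j)).
  record SequentialPath : Set where
    field
      len   : ℕ
      edge  : Fin len → Cell Q 1
      chain : (j : Fin len) (j' : Fin len) → toℕ j' ≡ suc (toℕ j) →
              tgt (edge j) ≡ src (edge j')

  -- λ(e_i) ≠ λ(e_j) for i ≠ j, i.e. edges are pairwise non-≈.
  NonRepeatingEvents : Set
  NonRepeatingEvents = (p : SequentialPath) (i j : Fin (SequentialPath.len p)) →
    ¬ i ≡ j → ¬ (SequentialPath.edge p i ≈ SequentialPath.edge p j)

Sculptable : HDA → Set
Sculptable Q = ∃[ d ] Embedding (pointed Q) (Bulk d)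

module Submission where

-- (1) Non-repeating events are reflected by morphisms.  A morphism
--     Q → R sends the generators of ≈ to generators of ≈ and sequential
--     paths to sequential paths, so two ≈-related edges on a path in Q
--     give two ≈-related edges on a path in R.
--
-- (2) Every bulk B^d has non-repeating events.  A 1-cell of B^d has a
--     single ∗ at some position, its direction; ≈ preserves directions,
--     since both faces s_i q and t_i q of a 2-cell q keep the remaining ∗
--     of q.  Along a sequential path every coordinate of the vertices can
--     only go from 0 to 1, so after an edge of direction c has set
--     coordinate c to 1, no later edge can start at a vertex whose
--     coordinate c is 0, i.e. no later edge has direction c.
--
-- An embedding is in particular a morphism, which gives the theorem.

open import Defs
open import Data.Nat using (ℕ; zero; suc; _<_; _≤′_; ≤′-reflexive; ≤′-step)
open import Data.Nat.Properties using (≤⇒≤′; suc-injective)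
open import Data.Fin using (Fin; zero; suc; toℕ; inject₁)
open import Data.Fin.Properties using (toℕ-inject₁; <-cmp)
open import Data.Bool using (Bool; true; false)
open import Data.Product using (∃; _,_)
open import Relation.Nullary using (¬_)
open import Relation.Binary.Definitions using (tri<; tri≈; tri>)
open import Relation.Binary.PropositionalEquality
  using (_≡_; refl; sym; trans; cong; subst)

predecessor : ∀ {n m} (j : Fin n) → toℕ j ≡ suc m → ∃ λ (j′ : Fin n) → toℕ j′ ≡ m
predecessor (suc j) eq = inject₁ j , trans (toℕ-inject₁ j) (suc-injective eq)

module Reflect {P R : Pointed} (M : Morphism P R) where

  map-≈ : ∀ {e f} → _≈_ (pcs P) e f → _≈_ (pcs R) (map M 1 e) (map M 1 f)
  map-≈ (gen q i) =
    ≈-resp-≡ (map-face M false 1 i q) (map-face M true 1 i q) (gen (map M 2 q) i)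
    where
    ≈-resp-≡ : ∀ {e e′ f f′} → e′ ≡ e → f′ ≡ f → _≈_ (pcs R) e f → _≈_ (pcs R) e′ f′
    ≈-resp-≡ refl refl h = h
  map-≈ ≈refl        = ≈refl
  map-≈ (≈sym h)     = ≈sym (map-≈ h)
  map-≈ (≈trans h k) = ≈trans (map-≈ h) (map-≈ k)

  map-path : SequentialPath (pcs P) → SequentialPath (pcs R)
  map-path p = record
    { len   = len
    ; edge  = λ j → map M 1 (edge j)
    ; chain = λ j j′ eq → map-link j j′ (chain j j′ eq)
    }
    where
    open SequentialPath p
    map-link : ∀ j j′ → tgt (pcs P) (edge j) ≡ src (pcs P) (edge j′) →
               tgt (pcs R) (map M 1 (edge j)) ≡ src (pcs R) (map M 1 (edge j′))
    map-link j j′ link =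
      trans (sym (map-face M true 0 zero (edge j)))
            (trans (cong (map M 0) link) (map-face M false 0 zero (edge j′)))

  reflect-nonRepeating : NonRepeatingEvents (pcs R) → NonRepeatingEvents (pcs P)
  reflect-nonRepeating nreR p i j i≢j e≈f = nreR (map-path p) i j i≢j (map-≈ e≈f)

direction : ∀ {d} → BCell d 1 → ℕ
direction (b0 x) = suc (direction x)
direction (b1 x) = suc (direction x)
direction (b* x) = zero

coordinate : ∀ {d} → ℕ → BCell d 0 → Bool
coordinate c       []     = false
coordinate zero    (b0 x) = false
coordinate zero    (b1 x) = true
coordinate (suc c) (b0 x) = coordinate c x
coordinate (suc c) (b1 x) = coordinate c x

source-direction : ∀ {d} (e : BCell d 1) → coordinate (direction e) (bface false zero e) ≡ false
source-direction (b0 e) = source-direction e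
source-direction (b1 e) = source-direction e
source-direction (b* e) = refl

target-direction : ∀ {d} (e : BCell d 1) → coordinate (direction e) (bface true zero e) ≡ true
target-direction (b0 e) = target-direction e
target-direction (b1 e) = target-direction e
target-direction (b* e) = refl

coordinate-monotone : ∀ {d} c (e : BCell d 1) →
  coordinate c (bface false zero e) ≡ true → coordinate c (bface true zero e) ≡ true
coordinate-monotone zero    (b0 e) ()
coordinate-monotone zero    (b1 e) _  = refl
coordinate-monotone zero    (b* e) ()
coordinate-monotone (suc c) (b0 e) h  = coordinate-monotone c e h
coordinate-monotone (suc c) (b1 e) h  = coordinate-monotone c e h
coordinate-monotone (suc c) (b* e) h  = h

opposite-faces-direction : ∀ {d} (q : BCell d 2) (i : Fin 2) →
  direction (bface false i q) ≡ direction (bface true i q)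
opposite-faces-direction (b0 q) i          = cong suc (opposite-faces-direction q i)
opposite-faces-direction (b1 q) i          = cong suc (opposite-faces-direction q i)
opposite-faces-direction (b* q) zero       = refl
opposite-faces-direction (b* q) (suc zero) = refl

≈-direction : ∀ {d} {e f : BCell d 1} → _≈_ (pcs (Bulk d)) e f → direction e ≡ direction f
≈-direction (gen q i)    = opposite-faces-direction q i
≈-direction ≈refl        = refl
≈-direction (≈sym h)     = sym (≈-direction h)
≈-direction (≈trans h k) = trans (≈-direction h) (≈-direction k)

module BulkPath {d : ℕ} (p : SequentialPath (pcs (Bulk d))) (c : ℕ) where
  open SequentialPath p

  OneAtSource OneAtTarget : Fin len → Set
  OneAtSource j = coordinate c (bface false zero (edge j)) ≡ true
  OneAtTarget j = coordinate c (bface true zero (edge j)) ≡ true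

  pass-vertex : ∀ j j′ → toℕ j′ ≡ suc (toℕ j) → OneAtTarget j → OneAtSource j′
  pass-vertex j j′ eq = subst (λ v → coordinate c v ≡ true) (chain j j′ eq)

  stays-one : ∀ i {n} → suc (toℕ i) ≤′ n → (j : Fin len) → toℕ j ≡ n →
              OneAtTarget i → OneAtSource j
  stays-one i (≤′-step later) j eq h with predecessor j eq
  ... | j′ , refl = pass-vertex j′ j eq
                      (coordinate-monotone c (edge j′) (stays-one i later j′ refl h))
  stays-one i (≤′-reflexive next) j eq h = pass-vertex i j (trans eq (sym next)) h

-- An earlier edge and a later edge of a path in the bulk are never ≈:
-- with c the common direction, coordinate c would be 1 at the source of the
-- later edge (propagated from the earlier one) and 0 there (its own direction).
bulk-earlier-later : ∀ {d} (p : SequentialPath (pcs (Bulk d))) (i j : Fin (SequentialPath.len p)) →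
  toℕ i < toℕ j → ¬ _≈_ (pcs (Bulk d)) (SequentialPath.edge p i) (SequentialPath.edge p j)
bulk-earlier-later p i j i<j e≈f with trans (sym set-at-j) reset-at-j
  where
  open SequentialPath p
  c : ℕ
  c = direction (edge j)
  set-at-j : coordinate c (bface false zero (edge j)) ≡ true
  set-at-j = BulkPath.stays-one p c i (≤⇒≤′ i<j) j refl
    (subst (λ c′ → coordinate c′ (bface true zero (edge i)) ≡ true)
           (≈-direction e≈f) (target-direction (edge i)))
  reset-at-j : coordinate c (bface false zero (edge j)) ≡ false
  reset-at-j = source-direction (edge j)
... | ()

bulk-nonRepeating : ∀ d → NonRepeatingEvents (pcs (Bulk d))
bulk-nonRepeating d p i j i≢j e≈f with <-cmp i j
... | tri< i<j _ _   = bulk-earlier-later p i j i<j e≈f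
... | tri≈ _ i≡j _   = i≢j i≡j
... | tri> _ _ j<i   = bulk-earlier-later p j i j<i (≈sym e≈f)

proposition4p2 : (Q : HDA) → ¬ NonRepeatingEvents (pcs (pointed Q)) →
    ¬ Sculptable Q
proposition4p2 Q repeating (d , embedding) =
  repeating (Reflect.reflect-nonRepeating (Embedding.morphism embedding) (bulk-nonRepeating d))
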